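{- For every integer $k\ge1$, $$U_k=\{\lfloor n\phi\rfloor F_k+nF_{k-1}-F_{k+1} : n\ge1\}.$$
   Context: $F_i$ are the Fibonacci numbers ($F_0=0,F_1=1,F_{m+1}=F_m+F_{m-1}$), $\phi=(1+\sqrt5)/2$. Every positive integer has a unique Zeckendorf representation as a sum of Fibonacci numbers $F_i$ with distinct indices $i\ge2$, no two consecutive; $0$ is the empty sum. For $k\ge0$, $U_k$ is the set of nonnegative integers whose Zeckendorf representation uses only Fibonacci numbers $F_i$ with $i\ge k+2$ (equivalently, whose least-significant-digit-first Zeckendorf digit string begins with $k$ zeros); in particular $0\in U_k$. -}

module Defs where

open import Data.Nat using (ℕ; zero; suc; _+_; _*_; _∸_; _≤_; _<_)
open import Data.List using (List; []; _∷_; map)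
open import Data.Nat.ListAction using (sum)
open import Data.List.Relation.Unary.All using (All)
open import Data.Product using (Σ; _×_)
open import Relation.Binary.PropositionalEquality using (_≡_)

fib : ℕ → ℕ
fib zero = 0
fib (suc zero) = 1
fib (suc (suc m)) = fib (suc m) + fib m

data NonConsecFrom : ℕ → List ℕ → Set where
  []  : ∀ {b} → NonConsecFrom b []
  _∷_ : ∀ {b i is} → b ≤ i → NonConsecFrom (2 + i) is → NonConsecFrom b (i ∷ is)

ZeckRep : ℕ → List ℕ → Set
ZeckRep x is = NonConsecFrom 2 is × sum (map fib is) ≡ x

-- U k : x's Zeckendorf representation uses only F_i with i ≥ k+2
-- (the representation is unique, so "some representation" = "the representation").
U : ℕ → ℕ → Set
U k x = Σ (List ℕ) λ is → ZeckRep x is × All (λ i → k + 2 ≤ i) is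

-- IsFloorPhi n m  ⇔  m = ⌊ n φ ⌋, φ = (1+√5)/2, expressed in exact ℕ arithmetic:
--   m ≤ nφ      ⇔  (2m ∸ n)² ≤ 5n²
--   nφ < m + 1  ⇔  5n² < (2(m+1) ∸ n)²
IsFloorPhi : ℕ → ℕ → Set
IsFloorPhi n m =
  ((2 * m ∸ n) * (2 * m ∸ n) ≤ 5 * (n * n)) ×
  (5 * (n * n) < (2 * (m + 1) ∸ n) * (2 * (m + 1) ∸ n))

-- With ψ = −1/φ one has F(j+1) − φ F(j) = ψ^j.  So if x = Σ_{j∈L} F(j+k) for a Zeckendorf
-- index list L, then x = A F(k) + B F(k−1) with A = Σ F(j+1), B = Σ F(j), and
-- A − φ B = Σ_{j∈L} ψ^j.  For indices j ≥ 2, no two consecutive, this sum lies strictly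
-- between −ψ = 1/φ and −ψ² = −1/φ², so (A+1) − φ(B+1) = Σ ψ^j + ψ lies in (−1, 0):
-- A + 1 = ⌊(B+1)φ⌋.  Conversely, every n ≥ 1 is B + 1 for the Zeckendorf list of n − 1, and
-- the floor is unique.
module Submission where

open import Defs
open import Data.Nat using (ℕ; zero; suc; _+_; _*_; _∸_; _≤_; _<_; z≤n; s≤s; _<?_; _≤?_; _≤′_; ≤′-refl; ≤′-step)
open import Data.Nat.Properties
open import Data.Nat.Tactic.RingSolver using (solve-∀)
open import Data.Nat.ListAction using (sum)
open import Data.Nat.ListAction.Properties using (sum-++)
open import Data.List using (List; []; _∷_; [_]; map; _++_)
open import Data.List.Properties using (map-++)
open import Data.List.Relation.Unary.All as All using (All; []; _∷_)
open import Data.List.Relation.Unary.All.Properties using (++⁺)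
open import Algebra.Properties.CommutativeSemigroup +-commutativeSemigroup using () renaming (interchange to +-interchange)
open import Data.Product using (Σ; ∃; _×_; _,_)
open import Data.Empty using (⊥-elim)
open import Function using (_∘_)
open import Relation.Binary.PropositionalEquality using (_≡_; refl; sym; trans; cong; cong₂; subst; subst₂; module ≡-Reasoning)
open import Relation.Nullary using (Dec; yes; no)

-- Comparison with φ: m ⋚ φ n iff m² ⋚ mn + n², as φ is the positive root of x² = x + 1.

_>φ_ _<φ_ _≥φ_ _≤φ_ : ℕ → ℕ → Set
m >φ n = m * n + n * n < m * m
m <φ n = m * m < m * n + n * n
m ≥φ n = m * n + n * n ≤ m * m
m ≤φ n = m * m ≤ m * n + n * n

-- With u = 2m − n, 4(m² − mn − n²) = u² − 5n², so m ⋚ φ n becomes u ⋚ √5 n.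
discriminant : ∀ m n u → 2 * m ≡ n + u →
  4 * (m * n + n * n) + u * u ≡ 4 * (m * m) + 5 * (n * n)
discriminant m n u 2m≡n+u = begin
  4 * (m * n + n * n) + u * u            ≡⟨ expandˡ m n u ⟩
  2 * (2 * m * n) + 4 * (n * n) + u * u  ≡⟨ cong (λ v → 2 * (v * n) + 4 * (n * n) + u * u) 2m≡n+u ⟩
  2 * ((n + u) * n) + 4 * (n * n) + u * u ≡⟨ complete n u ⟩
  (n + u) * (n + u) + 5 * (n * n)        ≡⟨ cong (λ v → v * v + 5 * (n * n)) (sym 2m≡n+u) ⟩
  2 * m * (2 * m) + 5 * (n * n)          ≡⟨ expandʳ m n ⟩
  4 * (m * m) + 5 * (n * n)              ∎
  where
  open ≡-Reasoning
  expandˡ : ∀ m n u → 4 * (m * n + n * n) + u * u ≡ 2 * (2 * m * n) + 4 * (n * n) + u * u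
  expandˡ = solve-∀
  complete : ∀ n u → 2 * ((n + u) * n) + 4 * (n * n) + u * u ≡ (n + u) * (n + u) + 5 * (n * n)
  complete = solve-∀
  expandʳ : ∀ m n → 2 * m * (2 * m) + 5 * (n * n) ≡ 4 * (m * m) + 5 * (n * n)
  expandʳ = solve-∀

2m≡n+[2m∸n] : ∀ m n → n ≤ 2 * m → 2 * m ≡ n + (2 * m ∸ n)
2m≡n+[2m∸n] _ _ n≤2m = sym (m+[n∸m]≡n n≤2m)

module _ (m n : ℕ) {u : ℕ} (2m≡n+u : 2 * m ≡ n + u) where

  private
    disc : 4 * (m * n + n * n) + u * u ≡ 4 * (m * m) + 5 * (n * n)
    disc = discriminant m n u 2m≡n+u

  >φ⇒5n²<u² : m >φ n → 5 * (n * n) < u * u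
  >φ⇒5n²<u² h = +-cancelˡ-< (4 * (m * m)) _ _
    (subst (_< 4 * (m * m) + u * u) disc (+-monoˡ-< (u * u) (*-monoʳ-< 4 h)))

  ≥φ⇒5n²≤u² : m ≥φ n → 5 * (n * n) ≤ u * u
  ≥φ⇒5n²≤u² h = +-cancelˡ-≤ (4 * (m * m)) _ _
    (subst (_≤ 4 * (m * m) + u * u) disc (+-monoˡ-≤ (u * u) (*-monoʳ-≤ 4 h)))

  <φ⇒u²<5n² : m <φ n → u * u < 5 * (n * n)
  <φ⇒u²<5n² h = +-cancelˡ-< (4 * (m * m)) _ _
    (subst (4 * (m * m) + u * u <_) disc (+-monoˡ-< (u * u) (*-monoʳ-< 4 h)))

  5n²<u²⇒>φ : 5 * (n * n) < u * u → m >φ n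
  5n²<u²⇒>φ h = *-cancelˡ-< 4 _ _ (+-cancelʳ-< (u * u) _ _
    (subst (_< 4 * (m * m) + u * u) (sym disc) (+-monoʳ-< (4 * (m * m)) h)))

≥φ⇒n≤2m : ∀ m n → m ≥φ n → n ≤ 2 * m
≥φ⇒n≤2m m n h with n ≤? 2 * m
... | yes n≤2m = n≤2m
... | no n≰2m = ⊥-elim (<⇒≱ m<φn h)
  where
  2m<n : 2 * m < n
  2m<n = ≰⇒> n≰2m
  m<φn : m <φ n
  m<φn = ≤-<-trans (*-monoʳ-≤ m (≤-trans (m≤m+n m (m + 0)) (<⇒≤ 2m<n)))
                   (m<m+n (m * n) (*-mono-< (≤-<-trans z≤n 2m<n) (≤-<-trans z≤n 2m<n)))

m*m≤n*n⇒m≤n : ∀ m n → m * m ≤ n * n → m ≤ n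
m*m≤n*n⇒m≤n m n h with n <? m
... | yes n<m = ⊥-elim (<⇒≱ (*-mono-< n<m n<m) h)
... | no n≮m = ≮⇒≥ n≮m

+-mono-≥φ->φ : ∀ m₁ n₁ m₂ n₂ → m₁ ≥φ n₁ → m₂ >φ n₂ → (m₁ + m₂) >φ (n₁ + n₂)
+-mono-≥φ->φ m₁ n₁ m₂ n₂ h₁ h₂ = 5n²<u²⇒>φ (m₁ + m₂) (n₁ + n₂) 2m≡n+u (begin-strict
  5 * ((n₁ + n₂) * (n₁ + n₂))                           ≡⟨ expand n₁ n₂ ⟩
  5 * (n₁ * n₁) + 2 * (5 * (n₁ * n₂)) + 5 * (n₂ * n₂)   <⟨ +-mono-≤-< (+-mono-≤ d₁ (*-monoʳ-≤ 2 cross)) d₂ ⟩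
  u₁ * u₁ + 2 * (u₁ * u₂) + u₂ * u₂                     ≡⟨ square u₁ u₂ ⟩
  (u₁ + u₂) * (u₁ + u₂)                                 ∎)
  where
  open ≤-Reasoning
  u₁ u₂ : ℕ
  u₁ = 2 * m₁ ∸ n₁
  u₂ = 2 * m₂ ∸ n₂
  e₁ : 2 * m₁ ≡ n₁ + u₁
  e₁ = 2m≡n+[2m∸n] m₁ n₁ (≥φ⇒n≤2m m₁ n₁ h₁)
  e₂ : 2 * m₂ ≡ n₂ + u₂
  e₂ = 2m≡n+[2m∸n] m₂ n₂ (≥φ⇒n≤2m m₂ n₂ (<⇒≤ h₂))
  d₁ : 5 * (n₁ * n₁) ≤ u₁ * u₁
  d₁ = ≥φ⇒5n²≤u² m₁ n₁ e₁ h₁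
  d₂ : 5 * (n₂ * n₂) < u₂ * u₂
  d₂ = >φ⇒5n²<u² m₂ n₂ e₂ h₂
  cross : 5 * (n₁ * n₂) ≤ u₁ * u₂
  cross = m*m≤n*n⇒m≤n _ _ (subst₂ _≤_ (products n₁ n₂) (products′ u₁ u₂) (*-mono-≤ d₁ (<⇒≤ d₂)))
    where
    products : ∀ a b → 5 * (a * a) * (5 * (b * b)) ≡ 5 * (a * b) * (5 * (a * b))
    products = solve-∀
    products′ : ∀ a b → a * a * (b * b) ≡ a * b * (a * b)
    products′ = solve-∀
  expand : ∀ a b → 5 * ((a + b) * (a + b)) ≡ 5 * (a * a) + 2 * (5 * (a * b)) + 5 * (b * b)
  expand = solve-∀
  square : ∀ a b → a * a + 2 * (a * b) + b * b ≡ (a + b) * (a + b)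
  square = solve-∀
  2m≡n+u : 2 * (m₁ + m₂) ≡ (n₁ + n₂) + (u₁ + u₂)
  2m≡n+u = begin-equality
    2 * (m₁ + m₂)              ≡⟨ *-distribˡ-+ 2 m₁ m₂ ⟩
    2 * m₁ + 2 * m₂            ≡⟨ cong₂ _+_ e₁ e₂ ⟩
    (n₁ + u₁) + (n₂ + u₂)      ≡⟨ +-interchange n₁ u₁ n₂ u₂ ⟩
    (n₁ + n₂) + (u₁ + u₂)      ∎

private
  flip-lhs : ∀ m n → (m + n) * m + m * m ≡ m * m + (m * m + m * n)
  flip-lhs = solve-∀
  flip-rhs : ∀ m n → (m + n) * (m + n) ≡ (m * n + n * n) + (m * m + m * n)
  flip-rhs = solve-∀

-- (m, n) ↦ (m + n, m) multiplies m − φ n by −1/φ.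
module _ (m n : ℕ) where

  <φ⇒+>φ : m <φ n → (m + n) >φ m
  <φ⇒+>φ h = subst₂ _<_ (sym (flip-lhs m n)) (sym (flip-rhs m n)) (+-monoˡ-< _ h)

  >φ⇒+<φ : m >φ n → (m + n) <φ m
  >φ⇒+<φ h = subst₂ _<_ (sym (flip-rhs m n)) (sym (flip-lhs m n)) (+-monoˡ-< _ h)

  ≤φ⇒+≥φ : m ≤φ n → (m + n) ≥φ m
  ≤φ⇒+≥φ h = subst₂ _≤_ (sym (flip-lhs m n)) (sym (flip-rhs m n)) (+-monoˡ-≤ _ h)

  +>φ⇒<φ : (m + n) >φ m → m <φ n
  +>φ⇒<φ h = +-cancelʳ-< _ _ _ (subst₂ _<_ (flip-lhs m n) (flip-rhs m n) h)

+-mono-≤φ-<φ : ∀ m₁ n₁ m₂ n₂ → m₁ ≤φ n₁ → m₂ <φ n₂ → (m₁ + m₂) <φ (n₁ + n₂)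
+-mono-≤φ-<φ m₁ n₁ m₂ n₂ h₁ h₂ = +>φ⇒<φ (m₁ + m₂) (n₁ + n₂)
  (subst (_>φ (m₁ + m₂)) (+-interchange m₁ n₁ m₂ n₂)
    (+-mono-≥φ->φ (m₁ + n₁) m₁ (m₂ + n₂) m₂ (≤φ⇒+≥φ m₁ n₁ h₁) (<φ⇒+>φ m₂ n₂ h₂)))

-- Sign c m n: m − φ n is nonzero with the sign of (−1)^c.

Sign : ℕ → ℕ → ℕ → Set
Sign zero          = _>φ_
Sign (suc zero)    = _<φ_
Sign (suc (suc c)) = Sign c

Sign-flip : ∀ c {m n} → Sign c m n → Sign (suc c) (m + n) m
Sign-flip zero       {m} {n} = >φ⇒+<φ m n
Sign-flip (suc zero) {m} {n} = <φ⇒+>φ m n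
Sign-flip (suc (suc c))       = Sign-flip c

Sign-cancel : ∀ c {m₁ n₁ m₂ n₂} → Sign (suc c) m₂ n₂ → Sign c (m₁ + m₂) (n₁ + n₂) → Sign c m₁ n₁
Sign-cancel zero {m₁} {n₁} {m₂} {n₂} h₂ h with m₁ * n₁ + n₁ * n₁ <? m₁ * m₁
... | yes h₁ = h₁
... | no ¬h₁ = ⊥-elim (<-asym h (+-mono-≤φ-<φ m₁ n₁ m₂ n₂ (≮⇒≥ ¬h₁) h₂))
Sign-cancel (suc zero) {m₁} {n₁} {m₂} {n₂} h₂ h with m₁ * m₁ <? m₁ * n₁ + n₁ * n₁
... | yes h₁ = h₁
... | no ¬h₁ = ⊥-elim (<-asym h (+-mono-≥φ->φ m₁ n₁ m₂ n₂ (≮⇒≥ ¬h₁) h₂))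
Sign-cancel (suc (suc c)) = Sign-cancel c

Sign-fib : ∀ c → Sign c (fib (suc c)) (fib c)
Sign-fib zero    = s≤s z≤n
Sign-fib (suc c) = Sign-flip c (Sign-fib c)

-- Sums of ψ^j over Zeckendorf index lists, ψ = −1/φ

fibSum fibSucSum : List ℕ → ℕ
fibSum    L = sum (map fib L)
fibSucSum L = sum (map (fib ∘ suc) L)

-- a − φ b lies strictly between −ψ^c and −ψ^(c+1); recall ψ^j = F(j+1) − φ F(j).
Bracketed : ℕ → ℕ → ℕ → Set
Bracketed c a b = Sign (suc c) (a + fib (2 + c)) (b + fib (1 + c)) × Sign c (a + fib (1 + c)) (b + fib c)

Bracketed-weaken₁ : ∀ c {a b} → Bracketed (suc c) a b → Bracketed c a b
Bracketed-weaken₁ c {a} {b} (h₁ , h₂) =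
  h₂ , Sign-cancel c (Sign-fib (suc c)) (subst₂ (Sign c) (regroup a F₂ F₁) (regroup b F₁ F₀) h₁)
  where
  F₀ F₁ F₂ : ℕ
  F₀ = fib c
  F₁ = fib (1 + c)
  F₂ = fib (2 + c)
  regroup : ∀ a p q → a + (p + q) ≡ a + q + p
  regroup = solve-∀

Bracketed-weaken : ∀ {c d a b} → c ≤′ d → Bracketed d a b → Bracketed c a b
Bracketed-weaken ≤′-refl             h = h
Bracketed-weaken (≤′-step {n = d} c≤d) h = Bracketed-weaken c≤d (Bracketed-weaken₁ d h)

Bracketed-cons : ∀ c {a b} → Bracketed (2 + c) a b →
  Bracketed c (fib (2 + c) + a) (fib (1 + c) + b)
Bracketed-cons c {a} {b} (h₁ , h₂) =
  Sign-cancel (suc c) (Sign-fib c) (subst₂ (Sign (suc c)) (regroup₁ a F₂ F₁) (regroup₁ b F₁ F₀) h₁) ,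
  subst₂ (Sign c) (regroup₂ a F₂ F₁) (regroup₂ b F₁ F₀) h₂
  where
  F₀ F₁ F₂ : ℕ
  F₀ = fib c
  F₁ = fib (1 + c)
  F₂ = fib (2 + c)
  regroup₁ : ∀ a p q → a + (p + q + p) ≡ p + a + p + q
  regroup₁ = solve-∀
  regroup₂ : ∀ a p q → a + (p + q) ≡ p + a + q
  regroup₂ = solve-∀

Bracketed-fibSums : ∀ {c L} → NonConsecFrom (suc c) L → Bracketed c (fibSucSum L) (fibSum L)
Bracketed-fibSums {c} [] = Sign-fib (suc c) , Sign-fib c
Bracketed-fibSums (_∷_ {i = suc i} (s≤s c≤i) rest) =
  Bracketed-weaken (≤⇒≤′ c≤i) (Bracketed-cons i (Bracketed-fibSums rest))

IsFloorPhi-intro : ∀ n m → m <φ n → (m + 1) >φ n → IsFloorPhi n m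
IsFloorPhi-intro n m m<φn m+1>φn = lower , upper
  where
  lower : (2 * m ∸ n) * (2 * m ∸ n) ≤ 5 * (n * n)
  lower with n ≤? 2 * m
  ... | yes n≤2m = <⇒≤ (<φ⇒u²<5n² m n (2m≡n+[2m∸n] m n n≤2m) m<φn)
  ... | no n≰2m rewrite m≤n⇒m∸n≡0 (<⇒≤ (≰⇒> n≰2m)) = z≤n
  upper : 5 * (n * n) < (2 * (m + 1) ∸ n) * (2 * (m + 1) ∸ n)
  upper = >φ⇒5n²<u² (m + 1) n (2m≡n+[2m∸n] (m + 1) n (≥φ⇒n≤2m (m + 1) n (<⇒≤ m+1>φn))) m+1>φn

IsFloorPhi-≤ : ∀ n m m′ → IsFloorPhi n m → IsFloorPhi n m′ → m ≤ m′
IsFloorPhi-≤ n m m′ (lower , _) (_ , upper′) = ≮⇒≥ λ m′<m →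
  <⇒≱ upper′ (≤-trans (*-mono-≤ (d m′<m) (d m′<m)) lower)
  where
  d : m′ < m → 2 * (m′ + 1) ∸ n ≤ 2 * m ∸ n
  d m′<m = ∸-monoˡ-≤ n (*-monoʳ-≤ 2 (subst (_≤ m) (+-comm 1 m′) m′<m))

IsFloorPhi-unique : ∀ n m m′ → IsFloorPhi n m → IsFloorPhi n m′ → m ≡ m′
IsFloorPhi-unique n m m′ f f′ = ≤-antisym (IsFloorPhi-≤ n m m′ f f′) (IsFloorPhi-≤ n m′ m f′ f)

-- Here A + 1 < φ (B + 1) < A + 2: the sum is bracketed at level 1.
IsFloorPhi-fibSums : ∀ {L} → NonConsecFrom 2 L → IsFloorPhi (suc (fibSum L)) (suc (fibSucSum L))
IsFloorPhi-fibSums {L} nc with Bracketed-fibSums {1} nc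
... | above , below = IsFloorPhi-intro (suc B) (suc A)
  (subst₂ _<φ_ (+-comm A 1) (+-comm B 1) below)
  (subst₂ _>φ_ (+-suc A 1) (+-comm B 1) above)
  where
  A B : ℕ
  A = fibSucSum L
  B = fibSum L

fib-+ : ∀ m n → fib (m + suc n) ≡ fib (suc m) * fib (suc n) + fib m * fib n
fib-+ zero          n = identity (fib (suc n)) (fib n)
  where
  identity : ∀ x y → x ≡ 1 * x + 0 * y
  identity = solve-∀
fib-+ (suc zero)    n = identity (fib (suc n)) (fib n)
  where
  identity : ∀ x y → x + y ≡ 1 * x + 1 * y
  identity = solve-∀
fib-+ (suc (suc m)) n =
  trans (cong₂ _+_ (fib-+ (suc m) n) (fib-+ m n))
        (collect (fib (suc (suc m))) (fib (suc m)) (fib m) (fib (suc n)) (fib n))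
  where
  collect : ∀ a b c x y → a * x + b * y + (b * x + c * y) ≡ (a + b) * x + (b + c) * y
  collect = solve-∀

fibSum-shift : ∀ k L → fibSum (map (_+ suc k) L) ≡ fibSucSum L * fib (suc k) + fibSum L * fib k
fibSum-shift k []      = refl
fibSum-shift k (j ∷ L) =
  trans (cong₂ _+_ (fib-+ j k) (fibSum-shift k L))
        (collect (fib (suc j)) (fib j) (fibSucSum L) (fibSum L) (fib (suc k)) (fib k))
  where
  collect : ∀ a b c d x y → a * x + b * y + (c * x + d * y) ≡ (a + c) * x + (b + d) * y
  collect = solve-∀

fibSum-shift-+fib : ∀ k L → fibSum (map (_+ suc k) L) + fib (suc k + 1) ≡
  suc (fibSucSum L) * fib (suc k) + suc (fibSum L) * fib k
fibSum-shift-+fib k L = begin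
  fibSum (map (_+ suc k) L) + fib (suc k + 1)
    ≡⟨ cong₂ _+_ (fibSum-shift k L) (cong fib (+-comm (suc k) 1)) ⟩
  fibSucSum L * fib (suc k) + fibSum L * fib k + (fib (suc k) + fib k)
    ≡⟨ collect (fibSucSum L) (fibSum L) (fib (suc k)) (fib k) ⟩
  suc (fibSucSum L) * fib (suc k) + suc (fibSum L) * fib k ∎
  where
  open ≡-Reasoning
  collect : ∀ a b x y → a * x + b * y + (x + y) ≡ suc a * x + suc b * y
  collect = solve-∀

NonConsecFrom-All : ∀ {b L} → NonConsecFrom b L → All (b ≤_) L
NonConsecFrom-All []           = []
NonConsecFrom-All (b≤i ∷ rest) =
  b≤i ∷ All.map (λ {j} 2+i≤j → ≤-trans b≤i (≤-trans (m≤n+m _ 2) 2+i≤j)) (NonConsecFrom-All rest)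

NonConsecFrom-rebase : ∀ {b c L} → All (c ≤_) L → NonConsecFrom b L → NonConsecFrom c L
NonConsecFrom-rebase []          []         = []
NonConsecFrom-rebase (c≤i ∷ _) (_ ∷ rest) = c≤i ∷ rest

NonConsecFrom-shift : ∀ k {b L} → NonConsecFrom b L → NonConsecFrom (b + k) (map (_+ k) L)
NonConsecFrom-shift k []           = []
NonConsecFrom-shift k (b≤i ∷ rest) = +-monoˡ-≤ k b≤i ∷ NonConsecFrom-shift k rest

NonConsecFrom-unshift : ∀ k {b L} → NonConsecFrom (b + k) L →
  ∃ λ L′ → NonConsecFrom b L′ × map (_+ k) L′ ≡ L
NonConsecFrom-unshift k [] = [] , [] , refl
NonConsecFrom-unshift k {b} (_∷_ {i = i} b+k≤i rest) with i ∸ k | m∸n+n≡m (≤-trans (m≤n+m k b) b+k≤i)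
... | j | refl with NonConsecFrom-unshift k rest
...   | L′ , nc , refl = j ∷ L′ , +-cancelʳ-≤ k b j b+k≤i ∷ nc , refl

U-shift : ∀ k {L} → NonConsecFrom 2 L → U k (fibSum (map (_+ k) L))
U-shift k {L} nc =
  map (_+ k) L ,
  (NonConsecFrom-rebase (All.map (≤-trans (m≤m+n 2 k)) bounds) shifted , refl) ,
  All.map (λ {i} → subst (_≤ i) (+-comm 2 k)) bounds
  where
  shifted : NonConsecFrom (2 + k) (map (_+ k) L)
  shifted = NonConsecFrom-shift k nc
  bounds : All (2 + k ≤_) (map (_+ k) L)
  bounds = NonConsecFrom-All shifted

U-unshift : ∀ k {x} → U k x → ∃ λ L → NonConsecFrom 2 L × fibSum (map (_+ k) L) ≡ x
U-unshift k (is , (nc , sum≡x) , bounds)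
  with NonConsecFrom-unshift k (NonConsecFrom-rebase (All.map (λ {i} → subst (_≤ i) (+-comm k 2)) bounds) nc)
... | L , ncL , refl = L , ncL , sum≡x

NonConsecFrom-snoc : ∀ {b L j} → NonConsecFrom b L → All (λ i → 2 + i ≤ j) L → b ≤ j →
  NonConsecFrom b (L ++ [ j ])
NonConsecFrom-snoc []           []              b≤j = b≤j ∷ []
NonConsecFrom-snoc (b≤i ∷ rest) (2+i≤j ∷ gaps) _   = b≤i ∷ NonConsecFrom-snoc rest gaps 2+i≤j

ZeckBelow : ℕ → ℕ → Set
ZeckBelow t y = Σ (List ℕ) λ L → ZeckRep y L × All (_< t) L

ZeckBelow-suc : ∀ {t y} → ZeckBelow t y → ZeckBelow (suc t) y
ZeckBelow-suc (L , rep , L<t) = L , rep , All.map m<n⇒m<1+n L<t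

ZeckBelow-greedy : ∀ {t y} → fib (2 + t) ≤ y → ZeckBelow (suc t) (y ∸ fib (2 + t)) → ZeckBelow (3 + t) y
ZeckBelow-greedy {t} {y} F≤y (L , (nc , sum≡r) , L<t) =
  L ++ [ 2 + t ] ,
  (NonConsecFrom-snoc nc (All.map s≤s L<t) (s≤s (s≤s z≤n)) , sum≡y) ,
  ++⁺ (All.map (m<n⇒m<1+n ∘ m<n⇒m<1+n) L<t) (≤-refl ∷ [])
  where
  open ≡-Reasoning
  sum≡y : sum (map fib (L ++ [ 2 + t ])) ≡ y
  sum≡y = begin
    sum (map fib (L ++ [ 2 + t ]))           ≡⟨ cong sum (map-++ fib L [ 2 + t ]) ⟩
    sum (map fib L ++ [ fib (2 + t) ])       ≡⟨ sum-++ (map fib L) [ fib (2 + t) ] ⟩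
    sum (map fib L) + (fib (2 + t) + 0)      ≡⟨ cong₂ _+_ sum≡r (+-identityʳ _) ⟩
    y ∸ fib (2 + t) + fib (2 + t)            ≡⟨ m∸n+n≡m F≤y ⟩
    y                                        ∎

fib-remainder< : ∀ {t y} → fib (2 + t) ≤ y → y < fib (3 + t) → y ∸ fib (2 + t) < fib (1 + t)
fib-remainder< {t} F≤y y<F =
  +-cancelˡ-< (fib (2 + t)) _ _ (subst (_< fib (3 + t)) (sym (m+[n∸m]≡n F≤y)) y<F)

zeckendorf< : ∀ t y → y < fib t → ZeckBelow t y
zeckendorf< zero                y       ()
zeckendorf< (suc zero)          zero    _ = [] , ([] , refl) , []
zeckendorf< (suc zero)          (suc y) (s≤s ())
zeckendorf< (suc (suc zero))    zero    _ = [] , ([] , refl) , []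
zeckendorf< (suc (suc zero))    (suc y) (s≤s ())
zeckendorf< (suc (suc (suc t))) y y<F =
  greedy (y <? fib (2 + t)) (zeckendorf< (suc (suc t)) y) (zeckendorf< (suc t) (y ∸ fib (2 + t)))
  where
  greedy : Dec (y < fib (2 + t)) →
    (y < fib (2 + t) → ZeckBelow (2 + t) y) →
    (y ∸ fib (2 + t) < fib (1 + t) → ZeckBelow (1 + t) (y ∸ fib (2 + t))) →
    ZeckBelow (3 + t) y
  greedy (yes y<F′) below _         = ZeckBelow-suc (below y<F′)
  greedy (no y≮F′)  _     remainder =
    ZeckBelow-greedy (≮⇒≥ y≮F′) (remainder (fib-remainder< {t} (≮⇒≥ y≮F′) y<F))

0<fib[1+n] : ∀ n → 0 < fib (suc n)
0<fib[1+n] zero    = s≤s z≤n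
0<fib[1+n] (suc n) = ≤-trans (0<fib[1+n] n) (m≤m+n _ _)

n<fib[2+n] : ∀ n → n < fib (2 + n)
n<fib[2+n] zero    = s≤s z≤n
n<fib[2+n] (suc n) = subst (_≤ fib (3 + n)) (+-comm (suc n) 1) (+-mono-≤ (n<fib[2+n] n) (0<fib[1+n] n))

zeckendorf : ∀ y → ∃ (ZeckRep y)
zeckendorf y with zeckendorf< (2 + y) y (n<fib[2+n] y)
... | L , rep , _ = L , rep

lemma10 : (k : ℕ) → 1 ≤ k →
    ((x : ℕ) → U k x →
      Σ ℕ λ n → Σ ℕ λ m → 1 ≤ n × IsFloorPhi n m ×
        x + fib (k + 1) ≡ m * fib k + n * fib (k ∸ 1))
    ×
    ((n m : ℕ) → 1 ≤ n → IsFloorPhi n m →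
      Σ ℕ λ x → U k x × x + fib (k + 1) ≡ m * fib k + n * fib (k ∸ 1))
lemma10 (suc k) (s≤s z≤n) = U⇒floor , floor⇒U
  where
  U⇒floor : (x : ℕ) → U (suc k) x →
    Σ ℕ λ n → Σ ℕ λ m → 1 ≤ n × IsFloorPhi n m × x + fib (suc k + 1) ≡ m * fib (suc k) + n * fib k
  U⇒floor x Ux with U-unshift (suc k) Ux
  ... | L , nc , refl =
    suc (fibSum L) , suc (fibSucSum L) , s≤s z≤n , IsFloorPhi-fibSums nc , fibSum-shift-+fib k L

  floor⇒U : (n m : ℕ) → 1 ≤ n → IsFloorPhi n m →
    Σ ℕ λ x → U (suc k) x × x + fib (suc k + 1) ≡ m * fib (suc k) + n * fib k
  floor⇒U (suc y) m (s≤s z≤n) floor with zeckendorf y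
  ... | L , nc , refl =
    fibSum (map (_+ suc k) L) , U-shift (suc k) nc ,
    subst (λ m′ → fibSum (map (_+ suc k) L) + fib (suc k + 1) ≡ m′ * fib (suc k) + suc (fibSum L) * fib k)
          (IsFloorPhi-unique (suc (fibSum L)) (suc (fibSucSum L)) m (IsFloorPhi-fibSums nc) floor)
          (fibSum-shift-+fib k L)
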